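{- Let $G$ be the graph on vertices $x_1,\ldots,x_8$ with edges $x_1x_2, x_1x_3, x_1x_4, x_1x_5, x_2x_6, x_2x_8, x_3x_6, x_3x_8, x_4x_7, x_5x_7, x_6x_7, x_7x_8$. Then $G$ is gap-free, $\mathrm{Con}_3(G)$ is co-chordal, and $\Sigma_3(G)$ is shellable but not vertex decomposable.
   Context: A graph is gap-free if it has no two edges $e,e'$ forming an induced matching (disjoint with no edge between them). $\mathrm{Con}_3(G)$ is the $3$-uniform clutter on $V(G)$ whose circuits are the $3$-subsets $W$ with $G[W]$ connected; $\Sigma_3(G)$ is the simplicial complex generated by $V(G)\setminus W$ for such $W$. A $d$-uniform clutter is chordal if it has no circuits or has a $(d-1)$-set $Z$ whose closed neighborhood $Z\cup\{x\notin Z: x\in\mathcal E\subseteq Z\cup\{x\}\text{ for a circuit }\mathcal E\}$ is a clique (all $d$-subsets are circuits) and such that deleting all circuits containing $Z$ leaves a chordal clutter; co-chordal means the complement clutter is chordal. Vertex decomposable and shellable: standard. -}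

module Defs where

open import Data.Nat using (ℕ; _∸_)
open import Data.Fin using (Fin; #_; _<_)
open import Data.Fin.Subset using (Subset; _∈_; _∉_; _⊆_; _⊂_; _∪_; ∁; ⁅_⁆; _-_; ∣_∣; Nonempty)
open import Data.List using (List; []; _∷_; length; lookup)
open import Data.List.Membership.Propositional using () renaming (_∈_ to _∈ₗ_)
open import Data.List.Relation.Unary.Unique.Propositional using (Unique)
open import Data.Product using (Σ; ∃; ∃-syntax; _×_; _,_)
open import Data.Sum using (_⊎_)
open import Relation.Binary.PropositionalEquality using (_≡_; _≢_)
open import Relation.Nullary using (¬_)

Graph : ℕ → Set₁
Graph n = Fin n → Fin n → Set

GapFree : ∀ {n} → Graph n → Set
GapFree {n} Adj = ∀ (a b c d : Fin n) → Adj a b → Adj c d →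
  a ≢ c → a ≢ d → b ≢ c → b ≢ d →
  Adj a c ⊎ Adj a d ⊎ Adj b c ⊎ Adj b d

InducedConnected : ∀ {n} → Graph n → Subset n → Set
InducedConnected {n} Adj W = Nonempty W ×
  (∀ (S : Subset n) → S ⊆ W → Nonempty S → S ⊂ W →
     ∃[ u ] ∃[ v ] (u ∈ S × v ∈ W × v ∉ S × Adj u v))

Clutter : ℕ → Set₁
Clutter n = Subset n → Set

Con3 : ∀ {n} → Graph n → Clutter n
Con3 Adj W = ∣ W ∣ ≡ 3 × InducedConnected Adj W

Complement : ∀ {n} → ℕ → Clutter n → Clutter n
Complement d C W = ∣ W ∣ ≡ d × ¬ C W

InClosedNbhd : ∀ {n} → Clutter n → Subset n → Fin n → Set
InClosedNbhd C Z x = x ∈ Z ⊎ (x ∉ Z × ∃[ E ] (C E × x ∈ E × E ⊆ Z ∪ ⁅ x ⁆))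

ClosedNbhdIsClique : ∀ {n} → ℕ → Clutter n → Subset n → Set
ClosedNbhdIsClique {n} d C Z = ∀ (W : Subset n) → ∣ W ∣ ≡ d →
  (∀ x → x ∈ W → InClosedNbhd C Z x) → C W

DeleteCircuitsContaining : ∀ {n} → Clutter n → Subset n → Clutter n
DeleteCircuitsContaining C Z W = C W × ¬ (Z ⊆ W)

data Chordal {n : ℕ} (d : ℕ) : Clutter n → Set₁ where
  noCircuits : ∀ {C} → (∀ W → ¬ C W) → Chordal d C
  simplicialStep : ∀ {C} (Z : Subset n) → ∣ Z ∣ ≡ d ∸ 1 →
    ClosedNbhdIsClique d C Z →
    Chordal d (DeleteCircuitsContaining C Z) → Chordal d C

CoChordal : ∀ {n} → ℕ → Clutter n → Set₁
CoChordal d C = Chordal d (Complement d C)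

Complex : ℕ → Set₁
Complex n = Subset n → Set

Sigma3 : ∀ {n} → Graph n → Complex n
Sigma3 Adj F = ∃[ W ] (Con3 Adj W × F ⊆ ∁ W)

Facet : ∀ {n} → Complex n → Subset n → Set
Facet {n} Δ F = Δ F × (∀ (G : Subset n) → Δ G → ¬ (F ⊂ G))

-- shellable (Björner–Wachs, possibly non-pure): the facets admit an
-- ordering F₁,…,Fₘ such that for every i, ⟨F₁,…,F_{i-1}⟩ ∩ ⟨Fᵢ⟩ is
-- generated by a nonempty set of maximal proper faces of Fᵢ
-- (i.e. every face of it lies in some Fᵢ - x that belongs to it).
IsShelling : ∀ {n} → List (Subset n) → Set
IsShelling {n} L = ∀ (i j : Fin (length L)) → j < i →
  (∀ (G : Subset n) → G ⊆ lookup L i → (∃[ k ] (k < i × G ⊆ lookup L k)) →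
     ∃[ x ] (x ∈ lookup L i × G ⊆ lookup L i - x ×
              ∃[ k ] (k < i × lookup L i - x ⊆ lookup L k)))

Shellable : ∀ {n} → Complex n → Set
Shellable {n} Δ = ∃[ L ] (Unique L × (∀ F → (F ∈ₗ L → Facet Δ F) × (Facet Δ F → F ∈ₗ L)) × IsShelling L)

IsSimplex : ∀ {n} → Complex n → Set
IsSimplex {n} Δ = ∃[ F ] (∀ (G : Subset n) → (Δ G → G ⊆ F) × (G ⊆ F → Δ G))

link : ∀ {n} → Complex n → Fin n → Complex n
link Δ v F = v ∉ F × Δ (F ∪ ⁅ v ⁆)

deletion : ∀ {n} → Complex n → Fin n → Complex n
deletion Δ v F = v ∉ F × Δ F

data VertexDecomposable {n : ℕ} : Complex n → Set₁ where
  simplex : ∀ {Δ} → IsSimplex Δ → VertexDecomposable Δ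
  shedding : ∀ {Δ} (v : Fin n) → Δ ⁅ v ⁆ →
    VertexDecomposable (link Δ v) → VertexDecomposable (deletion Δ v) →
    (∀ F → Facet (link Δ v) F → ¬ Facet (deletion Δ v) F) →
    VertexDecomposable Δ

-- The graph G of Proposition 5.1;  x_i is # (i - 1)

edgesG : List (Fin 8 × Fin 8)
edgesG =
  (# 0 , # 1) ∷ (# 0 , # 2) ∷ (# 0 , # 3) ∷ (# 0 , # 4) ∷
  (# 1 , # 5) ∷ (# 1 , # 7) ∷ (# 2 , # 5) ∷ (# 2 , # 7) ∷
  (# 3 , # 6) ∷ (# 4 , # 6) ∷ (# 5 , # 6) ∷ (# 6 , # 7) ∷ []

AdjG : Graph 8
AdjG x y = (x , y) ∈ₗ edgesG ⊎ (y , x) ∈ₗ edgesG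

{-# OPTIONS --safe #-}
-- All four claims concern one graph on eight vertices, so they are finite checks,
-- evaluated by the type checker via decision procedures and certificates. The facets of
-- Σ₃(G) are the complements of the 26 connected triples, all of size five, and an explicit
-- order of them is a shelling. Con₃(G) is co-chordal via an elimination order of twenty
-- 2-sets, each with a clique of the complement clutter containing its closed neighbourhood.
-- Σ₃(G) is not vertex decomposable because no vertex is a shedding vertex: every v has a
-- 4-set that is a facet of both its link and its deletion; for x₁ this is {x₂,x₃,x₄,x₅},
-- since x₁ has no neighbour among x₆, x₇, x₈.
module Submission where

open import Defs
open import Data.Product using (_×_)
open import Relation.Nullary using (¬_)

open import Data.Bool using (Bool; true; false)
import Data.Bool.Properties as Bool
open import Data.Fin using (_<_)
open import Data.Fin.Properties using (all?; any?; _<?_)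
import Data.Fin.Properties as Fin
open import Data.Fin.Subset
  using (Subset; ⊤; _∈_; _⊆_; _⊂_; _∪_; _∩_; ∁; ⁅_⁆; _-_; ∣_∣)
open import Data.Fin.Subset.Properties
  using (_∈?_; _⊆?_; _⊂?_; nonempty?; anySubset?; x∈⁅x⁆; x∈p∩q⁺)
open import Data.List using (List; []; _∷_; lookup)
open import Data.List.Membership.Propositional using (find; lose) renaming (_∈_ to _∈ₗ_)
open import Data.List.Relation.Unary.Any using (Any)
import Data.List.Relation.Unary.Any as Any
import Data.List.Membership.DecPropositional as DecMembership
open import Data.List.Relation.Unary.Unique.DecPropositional using (unique?)
open import Data.Maybe using (Maybe; just; from-just; _>>=_)
import Data.Maybe as Maybe
open import Data.Nat using (ℕ; _∸_)
import Data.Nat.Properties as ℕ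
open import Data.Product using (∃-syntax; _,_; proj₁; proj₂)
import Data.Product.Properties as Product
open import Data.Vec using (Vec; []; _∷_)
import Data.Vec as Vec
open import Data.Vec.Properties using (≡-dec)
open import Function using (_∘_; flip)
open import Relation.Binary.PropositionalEquality using (_≡_)
open import Relation.Nullary using (Dec; yes; no)
open import Relation.Nullary.Decidable
  using (_×-dec_; _⊎-dec_; _→-dec_; ¬?; map′; dec⇒maybe; decidable-stable; from-yes; from-no)
open import Relation.Unary using (Decidable)

module _ {n : ℕ} where

  _≟ₛ_ : (p q : Subset n) → Dec (p ≡ q)
  _≟ₛ_ = ≡-dec Bool._≟_

  open DecMembership _≟ₛ_ using () renaming (_∈?_ to _∈ₗ?_)

  allSubsets? : {P : Subset n → Set} → Decidable P → Dec (∀ S → P S)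
  allSubsets? P? with anySubset? (¬? ∘ P?)
  ... | yes (S , ¬PS) = no λ ∀P → ¬PS (∀P S)
  ... | no ∄¬P = yes λ S → decidable-stable (P? S) λ ¬PS → ∄¬P (S , ¬PS)

  Enumerates : List (Subset n) → (Subset n → Set) → Set
  Enumerates L P = ∀ S → (S ∈ₗ L → P S) × (P S → S ∈ₗ L)

  enumerates? : {P : Subset n → Set} → Decidable P → ∀ L → Dec (Enumerates L P)
  enumerates? P? L = allSubsets? λ S → (S ∈ₗ? L →-dec P? S) ×-dec (P? S →-dec S ∈ₗ? L)

  decidable-byEnumeration : ∀ {L} {P : Subset n → Set} → Enumerates L P → Decidable P
  decidable-byEnumeration {L} enum S = map′ (proj₁ (enum S)) (proj₂ (enum S)) (S ∈ₗ? L)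

module _ {n : ℕ} {Adj : Graph n} (adj? : ∀ u v → Dec (Adj u v)) where

  gapFree? : Dec (GapFree Adj)
  gapFree? = all? λ a → all? λ b → all? λ c → all? λ d →
    adj? a b →-dec adj? c d →-dec
    ¬? (a Fin.≟ c) →-dec ¬? (a Fin.≟ d) →-dec ¬? (b Fin.≟ c) →-dec ¬? (b Fin.≟ d) →-dec
    (adj? a c ⊎-dec adj? a d ⊎-dec adj? b c ⊎-dec adj? b d)

  inducedConnected? : Decidable (InducedConnected Adj)
  inducedConnected? W = nonempty? W ×-dec allSubsets? λ S →
    S ⊆? W →-dec nonempty? S →-dec S ⊂? W →-dec
    any? λ u → any? λ v → u ∈? S ×-dec v ∈? W ×-dec ¬? (v ∈? S) ×-dec adj? u v

  con3? : Decidable (Con3 Adj)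
  con3? W = ∣ W ∣ ℕ.≟ 3 ×-dec inducedConnected? W

sigma3? : ∀ {n} {Adj : Graph n} {Ws} → Enumerates Ws (Con3 Adj) → Decidable (Sigma3 Adj)
sigma3? {Adj = Adj} {Ws} enum F = map′ fromAny toAny (Any.any? (λ W → F ⊆? ∁ W) Ws)
  where
  fromAny : Any (λ W → F ⊆ ∁ W) Ws → Sigma3 Adj F
  fromAny a = let W , W∈Ws , F⊆∁W = find a in W , proj₁ (enum W) W∈Ws , F⊆∁W

  toAny : Sigma3 Adj F → Any (λ W → F ⊆ ∁ W) Ws
  toAny (W , con3 , F⊆∁W) = lose (proj₂ (enum W) con3) F⊆∁W

module _ {n : ℕ} {Δ : Complex n} (Δ? : Decidable Δ) where

  facet? : Decidable (Facet Δ)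
  facet? F = Δ? F ×-dec allSubsets? λ G → map′ flip flip (F ⊂? G →-dec ¬? (Δ? G))

  link? : ∀ v → Decidable (link Δ v)
  link? v F = ¬? (v ∈? F) ×-dec Δ? (F ∪ ⁅ v ⁆)

  deletion? : ∀ v → Decidable (deletion Δ v)
  deletion? v F = ¬? (v ∈? F) ×-dec Δ? F

module _ {n : ℕ} {Δ : Complex n} where

  ¬isSimplex : (∀ v → Δ ⁅ v ⁆) → ¬ Δ ⊤ → ¬ IsSimplex Δ
  ¬isSimplex vertex ¬Δ⊤ (F , faces) =
    ¬Δ⊤ (proj₂ (faces ⊤) λ {v} _ → proj₁ (faces ⁅ v ⁆) (vertex v) (x∈⁅x⁆ v))

  ¬vertexDecomposable : ¬ IsSimplex Δ →
    (∀ v → ∃[ F ] (Facet (link Δ v) F × Facet (deletion Δ v) F)) →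
    ¬ VertexDecomposable Δ
  ¬vertexDecomposable ¬simplex _ (simplex isSimplex) = ¬simplex isSimplex
  ¬vertexDecomposable _ commonFacet (shedding v _ _ _ noCommonFacet) =
    let F , linkFacet , deletionFacet = commonFacet v in noCommonFacet F linkFacet deletionFacet

module _ {n : ℕ} where

  -- Björner–Wachs: it suffices to compare facets pairwise, which avoids quantifying over faces.
  PairwiseShelling : List (Subset n) → Set
  PairwiseShelling L = ∀ i k → k < i → ∃[ x ] (x ∈ lookup L i ×
    lookup L k ∩ lookup L i ⊆ lookup L i - x × ∃[ k′ ] (k′ < i × lookup L i - x ⊆ lookup L k′))

  pairwiseShelling? : ∀ L → Dec (PairwiseShelling L)
  pairwiseShelling? L = all? λ i → all? λ k → k <? i →-dec any? λ x →
    x ∈? lookup L i ×-dec lookup L k ∩ lookup L i ⊆? lookup L i - x ×-dec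
    any? λ k′ → k′ <? i ×-dec lookup L i - x ⊆? lookup L k′

  pairwiseShelling⇒isShelling : ∀ {L} → PairwiseShelling L → IsShelling L
  pairwiseShelling⇒isShelling shelling i _ _ G G⊆Fᵢ (k , k<i , G⊆Fₖ) =
    let x , x∈Fᵢ , Fₖ∩Fᵢ⊆Fᵢ-x , earlier = shelling i k k<i
    in x , x∈Fᵢ , (λ y∈G → Fₖ∩Fᵢ⊆Fᵢ-x (x∈p∩q⁺ (G⊆Fₖ y∈G , G⊆Fᵢ y∈G))) , earlier

module _ {n : ℕ} (d : ℕ) where

  complement? : {C : Clutter n} → Decidable C → Decidable (Complement d C)
  complement? C? W = ∣ W ∣ ℕ.≟ d ×-dec ¬? (C? W)

  closedNbhdIsClique-within : ∀ {C : Clutter n} {Z K} →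
    (∀ x → InClosedNbhd C Z x → x ∈ K) → (∀ W → W ⊆ K → ∣ W ∣ ≡ d → C W) →
    ClosedNbhdIsClique d C Z
  closedNbhdIsClique-within nbhd⊆K clique W ∣W∣≡d W⊆nbhd =
    clique W (λ {x} x∈W → nbhd⊆K x (W⊆nbhd x x∈W)) ∣W∣≡d

  module _ {C : Clutter n} (C? : Decidable C) where

    inClosedNbhd? : ∀ Z x → Dec (InClosedNbhd C Z x)
    inClosedNbhd? Z x = x ∈? Z ⊎-dec ¬? (x ∈? Z) ×-dec
      anySubset? λ E → C? E ×-dec x ∈? E ×-dec E ⊆? Z ∪ ⁅ x ⁆

    deleteCircuitsContaining? : ∀ Z → Decidable (DeleteCircuitsContaining C Z)
    deleteCircuitsContaining? Z W = C? W ×-dec ¬? (Z ⊆? W)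

  -- Each entry of the certificate is a (d-1)-set Z with a clique K containing its closed neighbourhood.
  chordal-byCertificate : {C : Clutter n} → Decidable C → List (Subset n × Subset n) →
    Maybe (Chordal d C)
  chordal-byCertificate C? [] = Maybe.map noCircuits (dec⇒maybe (allSubsets? (¬? ∘ C?)))
  chordal-byCertificate C? ((Z , K) ∷ certificate) = do
    ∣Z∣≡d-1 ← dec⇒maybe (∣ Z ∣ ℕ.≟ d ∸ 1)
    nbhd⊆K ← dec⇒maybe (all? λ x → inClosedNbhd? C? Z x →-dec x ∈? K)
    clique ← dec⇒maybe (allSubsets? λ W → W ⊆? K →-dec ∣ W ∣ ℕ.≟ d →-dec C? W)
    rest ← chordal-byCertificate (deleteCircuitsContaining? C? Z) certificate
    just (simplicialStep Z ∣Z∣≡d-1 (closedNbhdIsClique-within nbhd⊆K clique) rest)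

-- Subsets of V(G) are written as characteristic vectors over x₁, …, x₈.
I O : Bool
I = true
O = false

adjG? : ∀ u v → Dec (AdjG u v)
adjG? u v = (u , v) ∈ₑ? edgesG ⊎-dec (v , u) ∈ₑ? edgesG
  where open DecMembership (Product.≡-dec Fin._≟_ Fin._≟_) using () renaming (_∈?_ to _∈ₑ?_)

connectedTriples : List (Subset 8)
connectedTriples =
  (I ∷ I ∷ I ∷ O ∷ O ∷ O ∷ O ∷ O ∷ []) ∷
  (I ∷ I ∷ O ∷ I ∷ O ∷ O ∷ O ∷ O ∷ []) ∷
  (I ∷ I ∷ O ∷ O ∷ I ∷ O ∷ O ∷ O ∷ []) ∷
  (I ∷ I ∷ O ∷ O ∷ O ∷ I ∷ O ∷ O ∷ []) ∷
  (I ∷ I ∷ O ∷ O ∷ O ∷ O ∷ O ∷ I ∷ []) ∷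
  (I ∷ O ∷ I ∷ I ∷ O ∷ O ∷ O ∷ O ∷ []) ∷
  (I ∷ O ∷ I ∷ O ∷ I ∷ O ∷ O ∷ O ∷ []) ∷
  (I ∷ O ∷ I ∷ O ∷ O ∷ I ∷ O ∷ O ∷ []) ∷
  (I ∷ O ∷ I ∷ O ∷ O ∷ O ∷ O ∷ I ∷ []) ∷
  (I ∷ O ∷ O ∷ I ∷ I ∷ O ∷ O ∷ O ∷ []) ∷
  (I ∷ O ∷ O ∷ I ∷ O ∷ O ∷ I ∷ O ∷ []) ∷
  (I ∷ O ∷ O ∷ O ∷ I ∷ O ∷ I ∷ O ∷ []) ∷
  (O ∷ I ∷ I ∷ O ∷ O ∷ I ∷ O ∷ O ∷ []) ∷
  (O ∷ I ∷ I ∷ O ∷ O ∷ O ∷ O ∷ I ∷ []) ∷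
  (O ∷ I ∷ O ∷ O ∷ O ∷ I ∷ I ∷ O ∷ []) ∷
  (O ∷ I ∷ O ∷ O ∷ O ∷ I ∷ O ∷ I ∷ []) ∷
  (O ∷ I ∷ O ∷ O ∷ O ∷ O ∷ I ∷ I ∷ []) ∷
  (O ∷ O ∷ I ∷ O ∷ O ∷ I ∷ I ∷ O ∷ []) ∷
  (O ∷ O ∷ I ∷ O ∷ O ∷ I ∷ O ∷ I ∷ []) ∷
  (O ∷ O ∷ I ∷ O ∷ O ∷ O ∷ I ∷ I ∷ []) ∷
  (O ∷ O ∷ O ∷ I ∷ I ∷ O ∷ I ∷ O ∷ []) ∷
  (O ∷ O ∷ O ∷ I ∷ O ∷ I ∷ I ∷ O ∷ []) ∷
  (O ∷ O ∷ O ∷ I ∷ O ∷ O ∷ I ∷ I ∷ []) ∷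
  (O ∷ O ∷ O ∷ O ∷ I ∷ I ∷ I ∷ O ∷ []) ∷
  (O ∷ O ∷ O ∷ O ∷ I ∷ O ∷ I ∷ I ∷ []) ∷
  (O ∷ O ∷ O ∷ O ∷ O ∷ I ∷ I ∷ I ∷ []) ∷
  []

connectedTriples-enumerates : Enumerates connectedTriples (Con3 AdjG)
connectedTriples-enumerates = from-yes (enumerates? (con3? adjG?) connectedTriples)

con3G? : Decidable (Con3 AdjG)
con3G? = decidable-byEnumeration connectedTriples-enumerates

sigma3G? : Decidable (Sigma3 AdjG)
sigma3G? = sigma3? connectedTriples-enumerates

shellingOrder : List (Subset 8)
shellingOrder =
  (O ∷ O ∷ O ∷ I ∷ I ∷ I ∷ I ∷ I ∷ []) ∷
  (O ∷ O ∷ I ∷ O ∷ I ∷ I ∷ I ∷ I ∷ []) ∷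
  (O ∷ O ∷ I ∷ I ∷ O ∷ I ∷ I ∷ I ∷ []) ∷
  (O ∷ O ∷ I ∷ I ∷ I ∷ O ∷ I ∷ I ∷ []) ∷
  (O ∷ O ∷ I ∷ I ∷ I ∷ I ∷ I ∷ O ∷ []) ∷
  (O ∷ I ∷ O ∷ O ∷ I ∷ I ∷ I ∷ I ∷ []) ∷
  (O ∷ I ∷ O ∷ I ∷ O ∷ I ∷ I ∷ I ∷ []) ∷
  (O ∷ I ∷ O ∷ I ∷ I ∷ O ∷ I ∷ I ∷ []) ∷
  (O ∷ I ∷ O ∷ I ∷ I ∷ I ∷ I ∷ O ∷ []) ∷
  (O ∷ I ∷ I ∷ O ∷ O ∷ I ∷ I ∷ I ∷ []) ∷
  (O ∷ I ∷ I ∷ O ∷ I ∷ I ∷ O ∷ I ∷ []) ∷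
  (O ∷ I ∷ I ∷ I ∷ O ∷ I ∷ O ∷ I ∷ []) ∷
  (I ∷ O ∷ O ∷ I ∷ I ∷ O ∷ I ∷ I ∷ []) ∷
  (I ∷ O ∷ O ∷ I ∷ I ∷ I ∷ I ∷ O ∷ []) ∷
  (I ∷ O ∷ I ∷ I ∷ I ∷ O ∷ O ∷ I ∷ []) ∷
  (I ∷ O ∷ I ∷ I ∷ I ∷ O ∷ I ∷ O ∷ []) ∷
  (I ∷ O ∷ I ∷ I ∷ I ∷ I ∷ O ∷ O ∷ []) ∷
  (I ∷ I ∷ O ∷ I ∷ I ∷ O ∷ O ∷ I ∷ []) ∷
  (I ∷ I ∷ O ∷ I ∷ I ∷ O ∷ I ∷ O ∷ []) ∷
  (I ∷ I ∷ O ∷ I ∷ I ∷ I ∷ O ∷ O ∷ []) ∷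
  (I ∷ I ∷ I ∷ O ∷ I ∷ O ∷ O ∷ I ∷ []) ∷
  (I ∷ I ∷ I ∷ O ∷ I ∷ I ∷ O ∷ O ∷ []) ∷
  (I ∷ I ∷ I ∷ O ∷ O ∷ I ∷ O ∷ I ∷ []) ∷
  (I ∷ I ∷ I ∷ I ∷ O ∷ O ∷ O ∷ I ∷ []) ∷
  (I ∷ I ∷ I ∷ I ∷ O ∷ I ∷ O ∷ O ∷ []) ∷
  (I ∷ I ∷ I ∷ I ∷ I ∷ O ∷ O ∷ O ∷ []) ∷
  []

sigma3G-shellable : Shellable (Sigma3 AdjG)
sigma3G-shellable = shellingOrder , from-yes (unique? _≟ₛ_ shellingOrder) ,
  from-yes (enumerates? (facet? sigma3G?) shellingOrder) ,
  pairwiseShelling⇒isShelling (from-yes (pairwiseShelling? shellingOrder))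

commonFacets : Vec (Subset 8) 8
commonFacets =
  (O ∷ I ∷ I ∷ I ∷ I ∷ O ∷ O ∷ O ∷ []) ∷
  (I ∷ O ∷ I ∷ O ∷ O ∷ I ∷ O ∷ I ∷ []) ∷
  (I ∷ I ∷ O ∷ O ∷ O ∷ I ∷ O ∷ I ∷ []) ∷
  (I ∷ O ∷ O ∷ O ∷ I ∷ O ∷ I ∷ I ∷ []) ∷
  (I ∷ O ∷ O ∷ I ∷ O ∷ O ∷ I ∷ I ∷ []) ∷
  (O ∷ I ∷ I ∷ O ∷ O ∷ O ∷ I ∷ I ∷ []) ∷
  (O ∷ O ∷ O ∷ I ∷ I ∷ I ∷ O ∷ I ∷ []) ∷
  (O ∷ I ∷ I ∷ O ∷ O ∷ I ∷ I ∷ O ∷ []) ∷ []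

sigma3G-¬vertexDecomposable : ¬ VertexDecomposable (Sigma3 AdjG)
sigma3G-¬vertexDecomposable = ¬vertexDecomposable
  (¬isSimplex (from-yes (all? λ v → sigma3G? ⁅ v ⁆)) (from-no (sigma3G? ⊤)))
  (λ v → Vec.lookup commonFacets v , commonFacet v)
  where
  commonFacet : ∀ v → let F = Vec.lookup commonFacets v in
    Facet (link (Sigma3 AdjG) v) F × Facet (deletion (Sigma3 AdjG) v) F
  commonFacet = from-yes (all? λ v → let F = Vec.lookup commonFacets v in
    facet? (link? sigma3G? v) F ×-dec facet? (deletion? sigma3G? v) F)

eliminationCertificate : List (Subset 8 × Subset 8)
eliminationCertificate =
  ((I ∷ I ∷ O ∷ O ∷ O ∷ O ∷ O ∷ O ∷ []) , (I ∷ I ∷ O ∷ O ∷ O ∷ O ∷ I ∷ O ∷ [])) ∷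
  ((I ∷ O ∷ I ∷ O ∷ O ∷ O ∷ O ∷ O ∷ []) , (I ∷ O ∷ I ∷ O ∷ O ∷ O ∷ I ∷ O ∷ [])) ∷
  ((I ∷ O ∷ O ∷ I ∷ O ∷ O ∷ O ∷ O ∷ []) , (I ∷ O ∷ O ∷ I ∷ O ∷ I ∷ O ∷ I ∷ [])) ∷
  ((I ∷ O ∷ O ∷ O ∷ I ∷ O ∷ O ∷ O ∷ []) , (I ∷ O ∷ O ∷ O ∷ I ∷ I ∷ O ∷ I ∷ [])) ∷
  ((O ∷ I ∷ O ∷ O ∷ O ∷ I ∷ O ∷ O ∷ []) , (O ∷ I ∷ O ∷ I ∷ I ∷ I ∷ O ∷ O ∷ [])) ∷
  ((O ∷ I ∷ O ∷ O ∷ O ∷ O ∷ O ∷ I ∷ []) , (O ∷ I ∷ O ∷ I ∷ I ∷ O ∷ O ∷ I ∷ [])) ∷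
  ((O ∷ O ∷ I ∷ O ∷ O ∷ I ∷ O ∷ O ∷ []) , (O ∷ O ∷ I ∷ I ∷ I ∷ I ∷ O ∷ O ∷ [])) ∷
  ((O ∷ O ∷ I ∷ O ∷ O ∷ O ∷ O ∷ I ∷ []) , (O ∷ O ∷ I ∷ I ∷ I ∷ O ∷ O ∷ I ∷ [])) ∷
  ((O ∷ O ∷ O ∷ I ∷ O ∷ I ∷ O ∷ O ∷ []) , (O ∷ O ∷ O ∷ I ∷ I ∷ I ∷ O ∷ I ∷ [])) ∷
  ((O ∷ O ∷ O ∷ I ∷ O ∷ O ∷ I ∷ O ∷ []) , (O ∷ I ∷ I ∷ I ∷ O ∷ O ∷ I ∷ O ∷ [])) ∷
  ((O ∷ I ∷ O ∷ I ∷ O ∷ O ∷ O ∷ O ∷ []) , (O ∷ I ∷ I ∷ I ∷ I ∷ O ∷ O ∷ O ∷ [])) ∷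
  ((O ∷ I ∷ I ∷ O ∷ O ∷ O ∷ O ∷ O ∷ []) , (O ∷ I ∷ I ∷ O ∷ I ∷ O ∷ I ∷ O ∷ [])) ∷
  ((O ∷ I ∷ O ∷ O ∷ I ∷ O ∷ O ∷ O ∷ []) , (O ∷ I ∷ O ∷ O ∷ I ∷ O ∷ I ∷ O ∷ [])) ∷
  ((O ∷ O ∷ I ∷ I ∷ O ∷ O ∷ O ∷ O ∷ []) , (O ∷ O ∷ I ∷ I ∷ I ∷ O ∷ O ∷ O ∷ [])) ∷
  ((O ∷ O ∷ I ∷ O ∷ I ∷ O ∷ O ∷ O ∷ []) , (O ∷ O ∷ I ∷ O ∷ I ∷ O ∷ I ∷ O ∷ [])) ∷
  ((O ∷ O ∷ O ∷ I ∷ I ∷ O ∷ O ∷ O ∷ []) , (O ∷ O ∷ O ∷ I ∷ I ∷ O ∷ O ∷ I ∷ [])) ∷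
  ((O ∷ O ∷ O ∷ O ∷ I ∷ I ∷ O ∷ O ∷ []) , (O ∷ O ∷ O ∷ O ∷ I ∷ I ∷ O ∷ I ∷ [])) ∷
  ((O ∷ O ∷ O ∷ O ∷ O ∷ I ∷ I ∷ O ∷ []) , (I ∷ O ∷ O ∷ O ∷ O ∷ I ∷ I ∷ O ∷ [])) ∷
  ((I ∷ O ∷ O ∷ O ∷ O ∷ I ∷ O ∷ O ∷ []) , (I ∷ O ∷ O ∷ O ∷ O ∷ I ∷ O ∷ I ∷ [])) ∷
  ((I ∷ O ∷ O ∷ O ∷ O ∷ O ∷ I ∷ O ∷ []) , (I ∷ O ∷ O ∷ O ∷ O ∷ O ∷ I ∷ I ∷ [])) ∷
  []

proposition5p1 : GapFree AdjG × CoChordal 3 (Con3 AdjG) ×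
    Shellable (Sigma3 AdjG) × ¬ VertexDecomposable (Sigma3 AdjG)
proposition5p1 =
  from-yes (gapFree? adjG?) ,
  from-just (chordal-byCertificate 3 (complement? 3 con3G?) eliminationCertificate) ,
  sigma3G-shellable ,
  sigma3G-¬vertexDecomposable
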